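{- Let $\mathbb K$ be a field of characteristic $0$ and let $G=\vec{C}_5^{1,2}$. Then for every $n\geq 1$, \[\dim_{\mathbb K}\Omega_n(G;\mathbb K)=10,\] and $\Omega_n(G;\mathbb K)$ is spanned by the ten elements $\alpha_a^{(n)},\beta_a^{(n)}$, $a\in\mathbb Z_5$ (two for each vertex $a$), where \begin{align*} \alpha_a^{(n)}&=e_{a,(a+1),(a+2),\ldots,(a+n)},\\ \beta_a^{(n)}&=\sum_{j=1}^n(-1)^{n-j}e_{a,a+1,\ldots,a+j-1,a+j+1,a+j+2,\ldots,a+n+1}, \end{align*} with all vertices understood modulo $5$.
   Context: GLMY path complex: for a finite digraph $G=(V,E)$ without loops and a field $\mathbb K$ of characteristic $0$, an elementary $n$-path is a sequence $e_{v_0v_1\cdots v_n}$ of vertices; $\Lambda_n$ is their $\mathbb K$-span with $\partial e_{v_0\cdots v_n}=\sum_{j=0}^n(-1)^j e_{v_0\cdots\widehat{v_j}\cdots v_n}$. Regular paths are obtained by quotienting by (i.e. setting to zero) elementary paths with $v_{k-1}=v_k$ for some $k$. $A_n(G;\mathbb K)$ is the span of regular elementary paths with $v_k\to v_{k+1}\in E$ for all $k$ (allowed paths). $\Omega_0=A_0$, $\Omega_1=A_1$, and for $n\ge 2$, $\Omega_n=\{u\in A_n:\partial u\in A_{n-1}\}$. The circulant digraph $\vec{C}_n^S$ (for $S\subset\mathbb Z_n$, $0\notin S$) has vertex set $\mathbb Z_n$ and an arrow $a\to a+s$ for each $a\in\mathbb Z_n$, $s\in S$; thus $\vec{C}_5^{1,2}$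 has arrows $a\to a+1$ and $a\to a+2$ mod $5$. -}

module Defs where

open import Level using (_⊔_)
open import Data.Nat as ℕ using (ℕ; zero; suc; _∸_; _<ᵇ_)
open import Data.Nat.DivMod using (_%_; m%n<n)
open import Data.Fin as Fin using (Fin; toℕ; fromℕ<)
open import Data.Fin.Properties using () renaming (_≟_ to _≟ᶠ_)
open import Data.Vec using (Vec; []; _∷_; insertAt; tabulate)
open import Data.Vec.Properties using (≡-dec)
open import Data.List using (List)
open import Data.List.Relation.Unary.Any using (Any)
open import Data.Product using (Σ; ∃; ∃-syntax; _×_; _,_)
open import Data.Unit using (⊤)
open import Data.Bool using (if_then_else_)
open import Relation.Nullary using (¬_; Dec; yes; no; does)
open import Relation.Binary.PropositionalEquality using (_≡_; _≢_)
open import Algebra.Bundles using (CommutativeRing)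

record Field c ℓ : Set (Level.suc (c ⊔ ℓ)) where
  field
    commutativeRing : CommutativeRing c ℓ
  open CommutativeRing commutativeRing public
  field
    1≉0     : ¬ (1# ≈ 0#)
    inverse : ∀ x → ¬ (x ≈ 0#) → ∃[ y ] (x * y ≈ 1#)

  fromℕ : ℕ → Carrier
  fromℕ zero    = 0#
  fromℕ (suc k) = 1# + fromℕ k

CharacteristicZero : ∀ {c ℓ} → Field c ℓ → Set ℓ
CharacteristicZero F = ∀ k → ¬ (fromℕ (suc k) ≈ 0#)
  where open Field F

-- GLMY path complex of a digraph with vertex set Fin m and arrow relation
-- Arrow, over a field F.
--  * an elementary n-path is a vector of n+1 vertices (Vec (Fin m) (suc n));
--  * a chain in Λ_n is a function Path n → K (all such are finitely
--    supported since the vertex set is finite); the chain u stands for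
--    Σ_p u(p) e_p;
--  * the regular quotient R_n = Λ_n / (span of non-regular paths) is
--    represented by chains, two chains being equal in R_n (_≈R_) when they
--    agree on all regular paths.

module Paths {c ℓ} (F : Field c ℓ) {m : ℕ} (Arrow : Fin m → Fin m → Set) where
  open Field F using (Carrier; _≈_; _+_; _*_; -_; 0#; 1#)

  V : Set
  V = Fin m

  Path : ℕ → Set
  Path n = Vec V (suc n)

  Chain : ℕ → Set c
  Chain n = Path n → Carrier

  ∑ : ∀ {k} → (Fin k → Carrier) → Carrier
  ∑ {zero}  f = 0#
  ∑ {suc k} f = f Fin.zero + ∑ (λ i → f (Fin.suc i))

  sgn : ℕ → Carrier
  sgn zero    = 1#
  sgn (suc k) = - sgn k

  Regular : ∀ {k} → Vec V k → Set
  Regular []            = ⊤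
  Regular (x ∷ [])      = ⊤
  Regular (x ∷ y ∷ xs)  = x ≢ y × Regular (y ∷ xs)

  regular? : ∀ {k} (xs : Vec V k) → Dec (Regular xs)
  regular? []           = yes _
  regular? (x ∷ [])     = yes _
  regular? (x ∷ y ∷ xs) with x ≟ᶠ y | regular? (y ∷ xs)
  ... | yes p | _     = no λ where (q , _) → q p
  ... | no p  | yes r = yes (p , r)
  ... | no p  | no r  = no λ where (_ , s) → r s

  Allowed : ∀ {k} → Vec V k → Set
  Allowed []            = ⊤
  Allowed (x ∷ [])      = ⊤
  Allowed (x ∷ y ∷ xs)  = Arrow x y × Allowed (y ∷ xs)

  _≈R_ : ∀ {n} → Chain n → Chain n → Set ℓ
  u ≈R v = ∀ w → Regular w → u w ≈ v w

  0R : ∀ {n} → Chain n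
  0R _ = 0#

  reg : ∀ {n} → Chain n → Chain n
  reg u w = if does (regular? w) then u w else 0#

  -- boundary ∂ e_{v0..vn+1} = Σ_j (-1)^j e_{v0..v̂j..vn+1}, in coefficients:
  -- (∂u)(w) = Σ_j (-1)^j Σ_v u(w with v inserted at position j),
  -- computed on the regular representative (the induced map on R).
  ∂ : ∀ {n} → Chain (suc n) → Chain n
  ∂ {n} u w = ∑ (λ (j : Fin (suc (suc n))) →
                  sgn (toℕ j) * ∑ (λ (v : V) → reg u (insertAt w j v)))

  e : ∀ {n} → Path n → Chain n
  e p w = if does (≡-dec _≟ᶠ_ w p) then 1# else 0#

  A : ∀ n → Chain n → Set ℓ
  A n u = ∀ w → Regular w → ¬ Allowed w → u w ≈ 0#

  Ω : ∀ n → Chain n → Set ℓ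
  Ω zero          u = A zero u
  Ω (suc zero)    u = A (suc zero) u
  Ω (suc (suc n)) u = A (suc (suc n)) u × A (suc n) (∂ u)

shift : ∀ {m} .{{_ : ℕ.NonZero m}} → Fin m → ℕ → Fin m
shift {m} a i = fromℕ< (m%n<n (toℕ a ℕ.+ i) m)

Circulant : ∀ m .{{_ : ℕ.NonZero m}} → List ℕ → Fin m → Fin m → Set
Circulant m S a b = Any (λ s → b ≡ shift a s) S

module C5-12 {c ℓ} (F : Field c ℓ) where
  open Field F using (Carrier; _≈_; _+_; _*_; -_; 0#; 1#)
  open import Data.List using (_∷_; [])
  open Paths F (Circulant 5 (1 ∷ 2 ∷ [])) public

  αpath : ∀ n → Fin 5 → Path n
  αpath n a = tabulate (λ i → shift a (toℕ i))

  βpath : ∀ n → Fin 5 → ℕ → Path n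
  βpath n a j = tabulate (λ i → if toℕ i <ᵇ j then shift a (toℕ i)
                                               else shift a (suc (toℕ i)))

  α : ∀ n → Fin 5 → Chain n
  α n a = e (αpath n a)

  β : ∀ n → Fin 5 → Chain n
  β n a w = ∑ (λ (k : Fin n) →
              sgn (n ∸ suc (toℕ k)) * e (βpath n a (suc (toℕ k))) w)

  lin : ∀ n → (Fin 5 → Carrier) → (Fin 5 → Carrier) → Chain n
  lin n cα cβ w = ∑ (λ a → cα a * α n a w + cβ a * β n a w)

{-# OPTIONS --safe #-}
module Submission where

-- A regular path of C₅^{1,2} is a walk a, a+d₁, a+d₁+d₂, … with steps dᵢ ∈ {1,2,3,4}, allowed iff
-- every dᵢ ∈ {1,2}.  Record u ∈ A_n, for each start a, by its profile G_a(w) = u(walk a w) on words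
-- w ∈ {1,2}ⁿ.  A non-allowed path is repaired by inserting one vertex only at a step +3 (as 1,2 or
-- 2,1) or +4 (as 2,2); hence ∂u ∈ A_{n-1} iff every profile satisfies G(…12…) + G(…21…) = 0 and
-- G(…22…) = 0 at every position.  The solutions vanish on words with several 2s and alternate in sign
-- along the words with a single 2, so G_a is determined by G_a(1…1) and G_a(1…12): these are the
-- coefficients of α_a and β_a.

open import Level using (_⊔_)
open import Function using (_∘_; id; case_of_)
open import Data.Nat as ℕ using (ℕ; zero; suc; _∸_; _≤_; _≥_; z≤n; s≤s; _<ᵇ_)
import Data.Nat.Properties as ℕₚ
open import Data.Nat.DivMod using (_%_; %-distribˡ-+; m%n%n≡m%n; m<n⇒m%n≡m)
open import Data.Fin as Fin using (Fin; toℕ)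
open import Data.Fin.Properties
  using (toℕ-injective; toℕ-fromℕ<; toℕ<n; toℕ-fromℕ; suc-injective; all?; any?; _≟_)
open import Data.Vec using (Vec; []; _∷_; map; replicate; tabulate; insertAt)
open import Data.Vec.Properties using (∷-injective; ∷-injectiveˡ; ∷-injectiveʳ; tabulate-cong; ≡-dec)
open import Data.List using () renaming (_∷_ to _∷ₗ_; [] to []ₗ)
open import Data.List.Relation.Unary.Any using (here; there)
open import Data.Product using (∃; ∃₂; _×_; _,_; proj₁; proj₂)
open import Data.Sum as ⊎ using (_⊎_; inj₁; inj₂; [_,_]′)
open import Data.Bool using (if_then_else_)
open import Data.Unit using (tt)
open import Data.Empty using (⊥-elim)
open import Relation.Nullary using (¬_; yes; no)
open import Relation.Nullary.Decidable using (from-yes; ¬?; _⊎-dec_; _→-dec_)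
open import Relation.Binary.PropositionalEquality as ≡ using (_≡_; _≢_; refl; cong; cong₂)
open import Defs

module _ where
  open import Data.Nat using (_+_)

  [m%n+k]%n≡[m+k]%n : ∀ m k n .{{_ : ℕ.NonZero n}} → (m % n + k) % n ≡ (m + k) % n
  [m%n+k]%n≡[m+k]%n m k n = begin
    (m % n + k) % n          ≡⟨ %-distribˡ-+ (m % n) k n ⟩
    (m % n % n + k % n) % n  ≡⟨ cong (λ x → (x + k % n) % n) (m%n%n≡m%n m n) ⟩
    (m % n + k % n) % n      ≡⟨ %-distribˡ-+ m k n ⟨
    (m + k) % n              ∎
    where open ≡.≡-Reasoning

  shift-zero : ∀ {m} .{{_ : ℕ.NonZero m}} (a : Fin m) → shift a 0 ≡ a
  shift-zero {m} a = toℕ-injective (begin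
    toℕ (shift a 0)  ≡⟨ toℕ-fromℕ< _ ⟩
    (toℕ a + 0) % m  ≡⟨ cong (_% m) (ℕₚ.+-identityʳ (toℕ a)) ⟩
    toℕ a % m        ≡⟨ m<n⇒m%n≡m (toℕ<n a) ⟩
    toℕ a            ∎)
    where open ≡.≡-Reasoning

  shift-shift : ∀ {m} .{{_ : ℕ.NonZero m}} (a : Fin m) i j → shift (shift a i) j ≡ shift a (i + j)
  shift-shift {m} a i j = toℕ-injective (begin
    toℕ (shift (shift a i) j)  ≡⟨ toℕ-fromℕ< _ ⟩
    (toℕ (shift a i) + j) % m  ≡⟨ cong (λ x → (x + j) % m) (toℕ-fromℕ< _) ⟩
    ((toℕ a + i) % m + j) % m  ≡⟨ [m%n+k]%n≡[m+k]%n (toℕ a + i) j m ⟩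
    (toℕ a + i + j) % m        ≡⟨ cong (_% m) (ℕₚ.+-assoc (toℕ a) i j) ⟩
    (toℕ a + (i + j)) % m      ≡⟨ toℕ-fromℕ< _ ⟨
    toℕ (shift a (i + j))      ∎)
    where open ≡.≡-Reasoning

module PathComplex {c ℓ} (K : Field c ℓ) {m : ℕ} (Arrow : Fin m → Fin m → Set) where
  open Field K renaming (refl to ≈-refl; sym to ≈-sym; trans to ≈-trans; reflexive to ≈-reflexive)
  open Paths K Arrow
  open import Algebra.Properties.Ring ring using (-‿distribˡ-*; -1*x≈-x)
  open import Algebra.Properties.AbelianGroup +-abelianGroup using (⁻¹-∙-comm)
  open import Algebra.Properties.Group +-group using (ε⁻¹≈ε; ⁻¹-involutive)
  open import Relation.Binary.Reasoning.Setoid setoid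

  x≈0⇒-x≈0 : ∀ {x} → x ≈ 0# → - x ≈ 0#
  x≈0⇒-x≈0 x≈0 = ≈-trans (-‿cong x≈0) ε⁻¹≈ε

  -x≈0⇒x≈0 : ∀ {x} → - x ≈ 0# → x ≈ 0#
  -x≈0⇒x≈0 {x} -x≈0 = ≈-trans (≈-sym (⁻¹-involutive x)) (x≈0⇒-x≈0 -x≈0)

  x≈0∧y≈0⇒x+y≈0 : ∀ {x y} → x ≈ 0# → y ≈ 0# → x + y ≈ 0#
  x≈0∧y≈0⇒x+y≈0 x≈0 y≈0 = ≈-trans (+-cong x≈0 y≈0) (+-identityˡ 0#)

  y≈0⇒x*y≈0 : ∀ {x y} → y ≈ 0# → x * y ≈ 0#
  y≈0⇒x*y≈0 {x} y≈0 = ≈-trans (*-congˡ y≈0) (zeroʳ x)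

  sgn-cancel : ∀ k x → sgn k * x + sgn (suc k) * x ≈ 0#
  sgn-cancel k x = ≈-trans (+-congˡ (≈-sym (-‿distribˡ-* (sgn k) x))) (-‿inverseʳ _)

  ∑-cong : ∀ {k} {f g : Fin k → Carrier} → (∀ i → f i ≈ g i) → ∑ f ≈ ∑ g
  ∑-cong {zero}  f≈g = ≈-refl
  ∑-cong {suc k} f≈g = +-cong (f≈g Fin.zero) (∑-cong (f≈g ∘ Fin.suc))

  ∑-zero : ∀ {k} {f : Fin k → Carrier} → (∀ i → f i ≈ 0#) → ∑ f ≈ 0#
  ∑-zero {zero}  f≈0 = ≈-refl
  ∑-zero {suc k} f≈0 = x≈0∧y≈0⇒x+y≈0 (f≈0 Fin.zero) (∑-zero (f≈0 ∘ Fin.suc))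

  ∑-single : ∀ {k} {f : Fin k → Carrier} i → (∀ j → j ≢ i → f j ≈ 0#) → ∑ f ≈ f i
  ∑-single Fin.zero f≈0 =
    ≈-trans (+-congˡ (∑-zero λ j → f≈0 (Fin.suc j) λ ())) (+-identityʳ _)
  ∑-single (Fin.suc i) f≈0 =
    ≈-trans (+-congʳ (f≈0 Fin.zero λ ()))
            (≈-trans (+-identityˡ _) (∑-single i λ j j≢i → f≈0 (Fin.suc j) (j≢i ∘ suc-injective)))

  ∑-pair : ∀ {k} {f : Fin k → Carrier} i j → i ≢ j → (∀ v → v ≢ i → v ≢ j → f v ≈ 0#) →
           ∑ f ≈ f i + f j
  ∑-pair Fin.zero Fin.zero i≢j _ = ⊥-elim (i≢j refl)
  ∑-pair Fin.zero (Fin.suc j) _ f≈0 =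
    +-congˡ (∑-single j λ v v≢j → f≈0 (Fin.suc v) (λ ()) (v≢j ∘ suc-injective))
  ∑-pair (Fin.suc i) Fin.zero _ f≈0 =
    ≈-trans (+-congˡ (∑-single i λ v v≢i → f≈0 (Fin.suc v) (v≢i ∘ suc-injective) (λ ())))
            (+-comm _ _)
  ∑-pair (Fin.suc i) (Fin.suc j) i≢j f≈0 =
    ≈-trans (+-congʳ (f≈0 Fin.zero (λ ()) (λ ())))
      (≈-trans (+-identityˡ _)
        (∑-pair i j (i≢j ∘ cong Fin.suc) λ v v≢i v≢j →
           f≈0 (Fin.suc v) (v≢i ∘ suc-injective) (v≢j ∘ suc-injective)))

  ∑-neg : ∀ {k} (f : Fin k → Carrier) → ∑ (λ i → - f i) ≈ - ∑ f
  ∑-neg {zero}  f = ≈-sym ε⁻¹≈ε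
  ∑-neg {suc k} f = ≈-trans (+-congˡ (∑-neg (f ∘ Fin.suc))) (⁻¹-∙-comm _ _)

  reg-regular : ∀ {n} (u : Chain n) {w} → Regular w → reg u w ≡ u w
  reg-regular u {w} r with regular? w
  ... | yes _ = refl
  ... | no ¬r = ⊥-elim (¬r r)

  e-self : ∀ {n} (p : Path n) → e p p ≡ 1#
  e-self p with ≡-dec _≟_ p p
  ... | yes _ = refl
  ... | no p≢p = ⊥-elim (p≢p refl)

  e-other : ∀ {n} {p w : Path n} → w ≢ p → e p w ≡ 0#
  e-other {p = p} {w} w≢p with ≡-dec _≟_ w p
  ... | yes w≡p = ⊥-elim (w≢p w≡p)
  ... | no _ = refl

  A⇒reg≈0 : ∀ {n} {u : Chain n} → A n u → ∀ w → ¬ Allowed w → reg u w ≈ 0#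
  A⇒reg≈0 Au w ¬allowed with regular? w
  ... | yes r = Au w r ¬allowed
  ... | no _  = ≈-refl

  startingAt : ∀ {n} → Fin m → Chain (suc n) → Chain n
  startingAt a u q = reg u (a ∷ q)

  reg-startingAt : ∀ {n} a (u : Chain (suc n)) (q : Path n) → reg (startingAt a u) q ≡ reg u (a ∷ q)
  reg-startingAt a u (b ∷ q) with a ≟ b | regular? (b ∷ q)
  ... | yes _ | yes _ = refl
  ... | yes _ | no _  = refl
  ... | no _  | yes _ = refl
  ... | no _  | no _  = refl

  A-startingAt : ∀ {n} a {u : Chain (suc n)} → A (suc n) u → A n (startingAt a u)
  A-startingAt a Au (b ∷ q) _ ¬allowed = A⇒reg≈0 Au (a ∷ b ∷ q) (¬allowed ∘ proj₂)

  ∂-cons : ∀ {n} (u : Chain (suc (suc n))) a (q : Path n) →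
           ∂ u (a ∷ q) ≈ ∑ (λ v → reg u (v ∷ a ∷ q)) - ∂ (startingAt a u) q
  ∂-cons u a q = +-cong (*-identityˡ _) (begin
    ∑ (λ j → - sgn (toℕ j) * ∑ (λ v → reg u (a ∷ insertAt q j v)))
      ≈⟨ ∑-cong (λ j → ≈-trans (≈-sym (-‿distribˡ-* (sgn (toℕ j)) _))
                        (-‿cong (*-congˡ (∑-cong λ v →
                          ≈-reflexive (≡.sym (reg-startingAt a u (insertAt q j v))))))) ⟩
    ∑ (λ j → - (sgn (toℕ j) * ∑ (λ v → reg (startingAt a u) (insertAt q j v))))
      ≈⟨ ∑-neg (λ j → sgn (toℕ j) * ∑ (λ v → reg (startingAt a u) (insertAt q j v))) ⟩
    - ∂ (startingAt a u) q ∎)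

  A-e : ∀ {n} {p : Path n} → Allowed p → A n (e p)
  A-e allowed w _ ¬allowed =
    ≈-reflexive (e-other λ w≡p → ¬allowed (≡.subst Allowed (≡.sym w≡p) allowed))

  ∂-nonArrow : ∀ {n} {u : Chain (suc (suc n))} → A _ u → ∀ a b (r : Vec (Fin m) n) → ¬ Arrow a b →
               ∂ u (a ∷ b ∷ r) ≈ - ∑ (λ v → reg u (a ∷ v ∷ b ∷ r))
  ∂-nonArrow {n} Au a b r ¬a→b =
    ≈-trans (+-cong (y≈0⇒x*y≈0 (∑-zero {m} λ v →
                       A⇒reg≈0 Au (v ∷ a ∷ b ∷ r) (¬a→b ∘ proj₁ ∘ proj₂)))
                    (+-congˡ (∑-zero {suc n} λ j → y≈0⇒x*y≈0 {sgn (suc (suc (toℕ j)))} (∑-zero {m} λ v →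
                       A⇒reg≈0 Au (a ∷ b ∷ insertAt r j v) (¬a→b ∘ proj₁)))))
      (≈-trans (+-identityˡ _) (≈-trans (+-identityʳ _) (-1*x≈-x _)))

  ∂-cons-nonAllowed : ∀ {n} {u : Chain (suc (suc n))} → A _ u → ∀ a (q : Path n) → ¬ Allowed q →
                      ∂ u (a ∷ q) ≈ - ∂ (startingAt a u) q
  ∂-cons-nonAllowed {u = u} Au a q@(_ ∷ _) ¬allowed =
    ≈-trans (∂-cons u a q)
      (≈-trans (+-congʳ (∑-zero {m} λ v → A⇒reg≈0 Au _ (¬allowed ∘ proj₂ ∘ proj₂)))
               (+-identityˡ _))

  ∂-nonArrow-nonAllowed : ∀ {n} {u : Chain (suc (suc n))} → A _ u → ∀ a b (r : Vec (Fin m) n) →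
                          ¬ Arrow a b → ¬ Allowed (b ∷ r) → ∂ u (a ∷ b ∷ r) ≈ 0#
  ∂-nonArrow-nonAllowed Au a b r ¬a→b ¬allowed =
    ≈-trans (∂-nonArrow Au a b r ¬a→b)
            (x≈0⇒-x≈0 (∑-zero {m} λ v → A⇒reg≈0 Au _ (¬allowed ∘ proj₂ ∘ proj₂)))

Step : Set
Step = Fin 4

pattern +1 = Fin.zero
pattern +2 = Fin.suc Fin.zero
pattern +3 = Fin.suc (Fin.suc Fin.zero)
pattern +4 = Fin.suc (Fin.suc (Fin.suc Fin.zero))

infixl 6 _⊕_
_⊕_ : Fin 5 → Step → Fin 5
a ⊕ d = shift a (suc (toℕ d))

⊕-≢ : ∀ a d → a ≢ a ⊕ d
⊕-≢ = from-yes (all? λ a → all? λ d → ¬? (a ≟ a ⊕ d))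

⊕-injective : ∀ a d d′ → a ⊕ d ≡ a ⊕ d′ → d ≡ d′
⊕-injective = from-yes (all? λ a → all? λ d → all? λ d′ → (a ⊕ d ≟ a ⊕ d′) →-dec (d ≟ d′))

equal-or-step : ∀ a b → a ≡ b ⊎ ∃ λ d → b ≡ a ⊕ d
equal-or-step = from-yes (all? λ a → all? λ b → (a ≟ b) ⊎-dec any? λ d → b ≟ a ⊕ d)

C5-Arrow : Fin 5 → Fin 5 → Set
C5-Arrow = Circulant 5 (1 ∷ₗ 2 ∷ₗ []ₗ)

arrow-step : ∀ a {b} → C5-Arrow a b → b ≡ a ⊕ +1 ⊎ b ≡ a ⊕ +2
arrow-step a (here b≡a+1)         = inj₁ b≡a+1
arrow-step a (there (here b≡a+2)) = inj₂ b≡a+2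

arrow-⊕ : ∀ a d → C5-Arrow a (a ⊕ d) → d ≡ +1 ⊎ d ≡ +2
arrow-⊕ a d = ⊎.map (⊕-injective a d +1) (⊕-injective a d +2) ∘ arrow-step a

¬arrow-+3 : ∀ a → ¬ C5-Arrow a (a ⊕ +3)
¬arrow-+3 a arr with arrow-⊕ a +3 arr
... | inj₁ ()
... | inj₂ ()

¬arrow-+4 : ∀ a → ¬ C5-Arrow a (a ⊕ +4)
¬arrow-+4 a arr with arrow-⊕ a +4 arr
... | inj₁ ()
... | inj₂ ()

visited : ∀ {k} → Fin 5 → Vec Step k → Vec (Fin 5) k
visited a []       = []
visited a (d ∷ ds) = a ⊕ d ∷ visited (a ⊕ d) ds

-- Defined so that walk a ds is definitionally a cons, as the boundary lemmas require.
walk : ∀ {k} → Fin 5 → Vec Step k → Vec (Fin 5) (suc k)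
walk a ds = a ∷ visited a ds

data Jump : Set where
  one two : Jump

jump : Jump → Step
jump one = +1
jump two = +2

jump-injective : ∀ {j j′} → jump j ≡ jump j′ → j ≡ j′
jump-injective {one} {one} _ = refl
jump-injective {two} {two} _ = refl

jump-arrow : ∀ a j → C5-Arrow a (a ⊕ jump j)
jump-arrow a one = here refl
jump-arrow a two = there (here refl)

allowedWalk : ∀ {k} → Fin 5 → Vec Jump k → Vec (Fin 5) (suc k)
allowedWalk a js = walk a (map jump js)

allowedWalk-injective : ∀ {k a a′} {js js′ : Vec Jump k} →
                        allowedWalk a js ≡ allowedWalk a′ js′ → a ≡ a′ × js ≡ js′
allowedWalk-injective {js = []} {[]} refl = refl , refl
allowedWalk-injective {a = a} {js = j ∷ js} {j′ ∷ js′} eq with ∷-injective eq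
... | refl , eq′ with jump-injective (⊕-injective a (jump j) (jump j′) (∷-injectiveˡ eq′))
... | refl = refl , cong (j ∷_) (proj₂ (allowedWalk-injective eq′))

allowedWalk-≢ˡ : ∀ {k a a′} {js js′ : Vec Jump k} → a ≢ a′ → allowedWalk a js ≢ allowedWalk a′ js′
allowedWalk-≢ˡ a≢a′ = a≢a′ ∘ proj₁ ∘ allowedWalk-injective

allowedWalk-≢ʳ : ∀ {k a a′} {js js′ : Vec Jump k} → js ≢ js′ → allowedWalk a js ≢ allowedWalk a′ js′
allowedWalk-≢ʳ js≢js′ = js≢js′ ∘ proj₂ ∘ allowedWalk-injective

twos : ∀ {k} → Vec Jump k → ℕ
twos []         = 0
twos (one ∷ js) = twos js
twos (two ∷ js) = suc (twos js)

twoAt : ∀ {k} → Fin k → Vec Jump k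
twoAt {suc k} Fin.zero = two ∷ replicate k one
twoAt (Fin.suc i)      = one ∷ twoAt i

twos-replicate : ∀ k → twos (replicate k one) ≡ 0
twos-replicate zero    = refl
twos-replicate (suc k) = twos-replicate k

twos-twoAt : ∀ {k} (i : Fin k) → twos (twoAt i) ≡ 1
twos-twoAt {suc k} Fin.zero = cong suc (twos-replicate k)
twos-twoAt (Fin.suc i)      = twos-twoAt i

twoAt-injective : ∀ {k} {i i′ : Fin k} → twoAt i ≡ twoAt i′ → i ≡ i′
twoAt-injective {i = Fin.zero}  {Fin.zero}   _  = refl
twoAt-injective {i = Fin.suc i} {Fin.suc i′} eq = cong Fin.suc (twoAt-injective (∷-injectiveʳ eq))
twoAt-injective {suc k} {Fin.zero} {Fin.suc i′} eq with ∷-injectiveˡ eq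
... | ()
twoAt-injective {suc k} {Fin.suc i} {Fin.zero} eq with ∷-injectiveˡ eq
... | ()

replicate≢twoAt : ∀ {k} (i : Fin k) → replicate k one ≢ twoAt i
replicate≢twoAt {k} i eq =
  ℕₚ.0≢1+n (≡.trans (≡.sym (twos-replicate k)) (≡.trans (cong twos eq) (twos-twoAt i)))

many≢replicate : ∀ {k} {js : Vec Jump k} → 2 ≤ twos js → js ≢ replicate k one
many≢replicate {k} 2≤ eq with ≡.subst (2 ≤_) (≡.trans (cong twos eq) (twos-replicate k)) 2≤
... | ()

many≢twoAt : ∀ {k} {js : Vec Jump k} {i} → 2 ≤ twos js → js ≢ twoAt i
many≢twoAt {i = i} 2≤ eq with ≡.subst (2 ≤_) (≡.trans (cong twos eq) (twos-twoAt i)) 2≤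
... | s≤s ()

replicate-or-two : ∀ {k} (js : Vec Jump k) → js ≡ replicate k one ⊎ 1 ≤ twos js
replicate-or-two []         = inj₁ refl
replicate-or-two (one ∷ js) = ⊎.map (cong (one ∷_)) id (replicate-or-two js)
replicate-or-two (two ∷ js) = inj₂ (s≤s z≤n)

data Shape : ∀ {k} → Vec Jump k → Set where
  noTwo     : ∀ {k} → Shape (replicate k one)
  singleTwo : ∀ {k} (i : Fin k) → Shape (twoAt i)
  manyTwos  : ∀ {k} {js : Vec Jump k} → 2 ≤ twos js → Shape js

shape : ∀ {k} (js : Vec Jump k) → Shape js
shape [] = noTwo
shape (one ∷ js) with shape js
... | noTwo       = noTwo
... | singleTwo i = singleTwo (Fin.suc i)
... | manyTwos p  = manyTwos p
shape (two ∷ js) with shape js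
... | noTwo       = singleTwo Fin.zero
... | singleTwo i = manyTwos (s≤s (ℕₚ.≤-reflexive (≡.sym (twos-twoAt i))))
... | manyTwos p  = manyTwos (ℕₚ.m≤n⇒m≤1+n p)

module C5 {c ℓ} (K : Field c ℓ) where
  open Field K renaming (refl to ≈-refl; sym to ≈-sym; trans to ≈-trans; reflexive to ≈-reflexive)
  open C5-12 K
  open PathComplex K C5-Arrow
  open import Algebra.Properties.Ring ring using (-‿distribˡ-*)
  open import Algebra.Properties.Group +-group using (inverseˡ-unique)
  open import Relation.Binary.Reasoning.Setoid setoid

  walk-regular : ∀ {k} a (ds : Vec Step k) → Regular (walk a ds)
  walk-regular a []       = tt
  walk-regular a (d ∷ ds) = ⊕-≢ a d , walk-regular (a ⊕ d) ds

  regular⇒walk : ∀ {n} (w : Path n) → Regular w → ∃₂ λ a ds → w ≡ walk a ds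
  regular⇒walk (a ∷ [])    _          = a , [] , refl
  regular⇒walk (a ∷ b ∷ w) (a≢b , r) with equal-or-step a b | regular⇒walk (b ∷ w) r
  ... | inj₁ a≡b      | _              = ⊥-elim (a≢b a≡b)
  ... | inj₂ (d , refl) | _ , ds , refl = a , d ∷ ds , refl

  allowedWalk-allowed : ∀ {k} a (js : Vec Jump k) → Allowed (allowedWalk a js)
  allowedWalk-allowed a []       = tt
  allowedWalk-allowed a (j ∷ js) = jump-arrow a j , allowedWalk-allowed (a ⊕ jump j) js

  allowed? : ∀ {k} (ds : Vec Step k) → (∃ λ js → ds ≡ map jump js) ⊎ (∀ a → ¬ Allowed (walk a ds))
  allowed? []        = inj₁ ([] , refl)
  allowed? (+1 ∷ ds) = ⊎.map (λ (js , eq) → one ∷ js , cong (+1 ∷_) eq)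
                             (λ ¬allowed a → ¬allowed _ ∘ proj₂) (allowed? ds)
  allowed? (+2 ∷ ds) = ⊎.map (λ (js , eq) → two ∷ js , cong (+2 ∷_) eq)
                             (λ ¬allowed a → ¬allowed _ ∘ proj₂) (allowed? ds)
  allowed? (+3 ∷ ds) = inj₂ λ a → ¬arrow-+3 a ∘ proj₁
  allowed? (+4 ∷ ds) = inj₂ λ a → ¬arrow-+4 a ∘ proj₁

  profile : ∀ {n} → Chain n → Fin 5 → Vec Jump n → Carrier
  profile u a js = reg u (allowedWalk a js)

  profile-regular : ∀ {n} (u : Chain n) a js → profile u a js ≡ u (allowedWalk a js)
  profile-regular u a js = reg-regular u (walk-regular a (map jump js))

  ∑-neighbours : ∀ {n} {u : Chain (suc n)} → A _ u → ∀ a (q : Vec (Fin 5) n) →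
                 ∑ (λ v → reg u (a ∷ v ∷ q)) ≈ reg u (a ∷ a ⊕ +1 ∷ q) + reg u (a ∷ a ⊕ +2 ∷ q)
  ∑-neighbours Au a q = ∑-pair (a ⊕ +1) (a ⊕ +2) (λ eq → case ⊕-injective a +1 +2 eq of λ ())
    λ v v≢a+1 v≢a+2 → A⇒reg≈0 Au (a ∷ v ∷ q) ([ v≢a+1 , v≢a+2 ]′ ∘ arrow-step a ∘ proj₁)

  ∂-at-+3 : ∀ {n} {u : Chain (suc (suc n))} → A _ u → ∀ a (t : Vec Step n) →
            ∂ u (walk a (+3 ∷ t)) ≈ - (reg u (walk a (+1 ∷ +2 ∷ t)) + reg u (walk a (+2 ∷ +1 ∷ t)))
  ∂-at-+3 {u = u} Au a t = begin
    ∂ u (walk a (+3 ∷ t))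
      ≈⟨ ∂-nonArrow Au a (a ⊕ +3) (visited (a ⊕ +3) t) (¬arrow-+3 a) ⟩
    - ∑ (λ v → reg u (a ∷ v ∷ walk (a ⊕ +3) t))
      ≈⟨ -‿cong (∑-neighbours Au a (walk (a ⊕ +3) t)) ⟩
    - (reg u (a ∷ a ⊕ +1 ∷ walk (a ⊕ +3) t) + reg u (a ∷ a ⊕ +2 ∷ walk (a ⊕ +3) t))
      ≡⟨ cong₂ (λ b b′ → - (reg u (a ∷ a ⊕ +1 ∷ walk b t) + reg u (a ∷ a ⊕ +2 ∷ walk b′ t)))
               (shift-shift a 1 2) (shift-shift a 2 1) ⟨
    - (reg u (walk a (+1 ∷ +2 ∷ t)) + reg u (walk a (+2 ∷ +1 ∷ t))) ∎

  ∂-at-+4 : ∀ {n} {u : Chain (suc (suc n))} → A _ u → ∀ a (t : Vec Step n) →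
            ∂ u (walk a (+4 ∷ t)) ≈ - reg u (walk a (+2 ∷ +2 ∷ t))
  ∂-at-+4 {u = u} Au a t = begin
    ∂ u (walk a (+4 ∷ t))
      ≈⟨ ∂-nonArrow Au a (a ⊕ +4) (visited (a ⊕ +4) t) (¬arrow-+4 a) ⟩
    - ∑ (λ v → reg u (a ∷ v ∷ walk (a ⊕ +4) t))
      ≈⟨ -‿cong (∑-neighbours Au a (walk (a ⊕ +4) t)) ⟩
    - (reg u (a ∷ a ⊕ +1 ∷ walk (a ⊕ +4) t) + reg u (a ∷ a ⊕ +2 ∷ walk (a ⊕ +4) t))
      ≈⟨ -‿cong (≈-trans (+-congʳ (A⇒reg≈0 Au _ (¬a+1→a+4 ∘ proj₁ ∘ proj₂))) (+-identityˡ _)) ⟩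
    - reg u (a ∷ a ⊕ +2 ∷ walk (a ⊕ +4) t)
      ≡⟨ cong (λ b → - reg u (a ∷ a ⊕ +2 ∷ walk b t)) (shift-shift a 2 2) ⟨
    - reg u (walk a (+2 ∷ +2 ∷ t)) ∎
    where
      ¬a+1→a+4 : ¬ C5-Arrow (a ⊕ +1) (a ⊕ +4)
      ¬a+1→a+4 = ¬arrow-+3 (a ⊕ +1) ∘ ≡.subst (C5-Arrow (a ⊕ +1)) (≡.sym (shift-shift a 1 3))

  -- For G = profile u a these say that ∂u vanishes at the walks from a with one step +3 or +4.
  data Relations : ∀ n → (Vec Jump n → Carrier) → Set (c ⊔ ℓ) where
    nil    : ∀ {G} → Relations 0 G
    single : ∀ {G} → Relations 1 G
    cons   : ∀ {n G} →
             (∀ t → G (one ∷ two ∷ t) + G (two ∷ one ∷ t) ≈ 0#) →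
             (∀ t → G (two ∷ two ∷ t) ≈ 0#) →
             (∀ j → Relations (suc n) (λ js → G (j ∷ js))) →
             Relations (suc (suc n)) G

  Relations-cong : ∀ {n G H} → Relations n G → (∀ js → G js ≈ H js) → Relations n H
  Relations-cong nil    _ = nil
  Relations-cong single _ = single
  Relations-cong (cons swap double tails) G≈H =
    cons (λ t → ≈-trans (≈-sym (+-cong (G≈H _) (G≈H _))) (swap t))
         (λ t → ≈-trans (≈-sym (G≈H _)) (double t))
         (λ j → Relations-cong (tails j) (G≈H ∘ (j ∷_)))

  -- G is the profile at a of c α_a + x β_a, where c = G (replicate n one).
  InSpan : ∀ n → (Vec Jump n → Carrier) → Carrier → Set ℓ
  InSpan n G x = (∀ js → 2 ≤ twos js → G js ≈ 0#)
               × (∀ k → G (twoAt k) ≈ sgn (n ∸ suc (toℕ k)) * x)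

  relations⇒vanish : ∀ {n G} → Relations n G → ∀ js → 2 ≤ twos js → G js ≈ 0#
  relations⇒vanish nil    []           ()
  relations⇒vanish single (one ∷ [])   ()
  relations⇒vanish single (two ∷ [])   (s≤s ())
  relations⇒vanish (cons _ _ tails) (one ∷ js) 2≤ = relations⇒vanish (tails one) js 2≤
  relations⇒vanish (cons _ double _) (two ∷ two ∷ t) _ = double t
  relations⇒vanish (cons swap _ tails) (two ∷ one ∷ t) 2≤ =
    ≈-trans (inverseˡ-unique _ _ (≈-trans (+-comm _ _) (swap t)))
            (x≈0⇒-x≈0 (relations⇒vanish (tails one) (two ∷ t) 2≤))

  relations⇒alternate : ∀ {n G} → Relations (suc n) G →
                        ∀ k → G (twoAt k) ≈ sgn (n ∸ toℕ k) * G (twoAt (Fin.fromℕ n))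
  relations⇒alternate single Fin.zero = ≈-sym (*-identityˡ _)
  relations⇒alternate {suc n} {G} (cons swap _ tails) Fin.zero = begin
    G (two ∷ one ∷ replicate n one)   ≈⟨ inverseˡ-unique _ _ (≈-trans (+-comm _ _) (swap (replicate n one))) ⟩
    - G (one ∷ two ∷ replicate n one) ≈⟨ -‿cong (relations⇒alternate (tails one) Fin.zero) ⟩
    - (sgn n * G last)                ≈⟨ -‿distribˡ-* (sgn n) (G last) ⟩
    sgn (suc n) * G last              ∎
    where
      last : Vec Jump (suc (suc n))
      last = twoAt (Fin.fromℕ (suc n))
  relations⇒alternate (cons _ _ tails) (Fin.suc k) = relations⇒alternate (tails one) k

  relations⇒inSpan : ∀ {n G} → Relations (suc n) G → InSpan (suc n) G (G (twoAt (Fin.fromℕ n)))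
  relations⇒inSpan rels = relations⇒vanish rels , relations⇒alternate rels

  inSpan⇒relations : ∀ n {G x} → InSpan n G x → Relations n G
  inSpan⇒tail-relations : ∀ n {G x} → InSpan (suc n) G x → ∀ j → Relations n (λ js → G (j ∷ js))

  inSpan⇒relations zero          _ = nil
  inSpan⇒relations (suc zero)    _ = single
  inSpan⇒relations (suc (suc n)) {G} {x} inSpan@(vanish , alternate) =
    cons swap (λ t → vanish (two ∷ two ∷ t) (s≤s (s≤s z≤n))) (inSpan⇒tail-relations (suc n) inSpan)
    where
      swap : ∀ t → G (one ∷ two ∷ t) + G (two ∷ one ∷ t) ≈ 0#
      swap t with replicate-or-two t
      ... | inj₁ refl = ≈-trans (+-cong (alternate (Fin.suc Fin.zero)) (alternate Fin.zero)) (sgn-cancel n x)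
      ... | inj₂ 1≤   = x≈0∧y≈0⇒x+y≈0 (vanish _ (s≤s 1≤)) (vanish _ (s≤s 1≤))

  inSpan⇒tail-relations n (vanish , alternate) one =
    inSpan⇒relations n ((λ js → vanish (one ∷ js)) , alternate ∘ Fin.suc)
  inSpan⇒tail-relations n (vanish , _) two = inSpan⇒relations n {x = 0#}
    ( (λ js 2≤ → vanish (two ∷ js) (ℕₚ.m≤n⇒m≤1+n 2≤))
    , λ k → ≈-trans (vanish (two ∷ twoAt k) (s≤s (ℕₚ.≤-reflexive (≡.sym (twos-twoAt k)))))
                    (≈-sym (zeroʳ _)))

  ∂-vanishes⇒relations : ∀ n {u : Chain (suc n)} a → A (suc n) u →
                     (∀ ds → ¬ Allowed (walk a ds) → ∂ u (walk a ds) ≈ 0#) →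
                     Relations (suc n) (profile u a)
  ∂-vanishes⇒relations zero    _ _ _ = single
  ∂-vanishes⇒relations (suc n) {u} a Au ∂u≈0 = cons swap double tails
    where
      swap : ∀ t → profile u a (one ∷ two ∷ t) + profile u a (two ∷ one ∷ t) ≈ 0#
      swap t = -x≈0⇒x≈0 (≈-trans (≈-sym (∂-at-+3 Au a (map jump t)))
                                 (∂u≈0 (+3 ∷ map jump t) (¬arrow-+3 a ∘ proj₁)))
      double : ∀ t → profile u a (two ∷ two ∷ t) ≈ 0#
      double t = -x≈0⇒x≈0 (≈-trans (≈-sym (∂-at-+4 Au a (map jump t)))
                                   (∂u≈0 (+4 ∷ map jump t) (¬arrow-+4 a ∘ proj₁)))
      tails : ∀ j → Relations (suc n) (λ js → profile u a (j ∷ js))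
      tails j = Relations-cong
        (∂-vanishes⇒relations n (a ⊕ jump j) (A-startingAt a Au) λ ds ¬allowed →
          -x≈0⇒x≈0 (≈-trans (≈-sym (∂-cons-nonAllowed Au a (walk (a ⊕ jump j) ds) ¬allowed))
                           (∂u≈0 (jump j ∷ ds) (¬allowed ∘ proj₂))))
        (λ js → ≈-reflexive (reg-startingAt a u (allowedWalk (a ⊕ jump j) js)))

  startingAt-relations : ∀ {n} {u : Chain (suc (suc n))} a → A _ u → Relations (suc (suc n)) (profile u a) →
                         ∀ b → Relations (suc n) (profile (startingAt a u) b)
  startingAt-relations {n} {u} a Au (cons _ _ tails) b with b ≟ a ⊕ +1 | b ≟ a ⊕ +2
  ... | yes refl | _        = Relations-cong (tails one) λ js → ≈-reflexive (≡.sym (reg-startingAt a u _))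
  ... | no _     | yes refl = Relations-cong (tails two) λ js → ≈-reflexive (≡.sym (reg-startingAt a u _))
  ... | no b≢a+1 | no b≢a+2 = inSpan⇒relations (suc n) {x = 0#}
    ((λ js _ → zero-profile js) , λ k → ≈-trans (zero-profile (twoAt k)) (≈-sym (zeroʳ _)))
    where
      zero-profile : ∀ js → profile (startingAt a u) b js ≈ 0#
      zero-profile js = ≈-trans (≈-reflexive (reg-startingAt a u (allowedWalk b js)))
                                (A⇒reg≈0 Au (a ∷ allowedWalk b js)
                                          ([ b≢a+1 , b≢a+2 ]′ ∘ arrow-step a ∘ proj₁))

  relations⇒∂-vanishes : ∀ n {u : Chain (suc n)} → A _ u → (∀ a → Relations (suc n) (profile u a)) →
               ∀ a (ds : Vec Step n) → ¬ Allowed (walk a ds) → ∂ u (walk a ds) ≈ 0#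
  relations⇒∂-vanishes-jump : ∀ n {u : Chain (suc (suc n))} → A _ u →
                              (∀ a → Relations (suc (suc n)) (profile u a)) →
                              ∀ a j (ds : Vec Step n) → ¬ Allowed (walk a (jump j ∷ ds)) →
                              ∂ u (walk a (jump j ∷ ds)) ≈ 0#

  relations⇒∂-vanishes zero _ _ a [] ¬allowed = ⊥-elim (¬allowed tt)
  relations⇒∂-vanishes (suc n) Au rels a (+1 ∷ ds) = relations⇒∂-vanishes-jump n Au rels a one ds
  relations⇒∂-vanishes (suc n) Au rels a (+2 ∷ ds) = relations⇒∂-vanishes-jump n Au rels a two ds
  relations⇒∂-vanishes (suc n) Au rels a (+3 ∷ ds) _ with allowed? ds | rels a
  ... | inj₁ (t , refl) | cons swap _ _ = ≈-trans (∂-at-+3 Au a (map jump t)) (x≈0⇒-x≈0 (swap t))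
  ... | inj₂ ¬allowed  | _             = ∂-nonArrow-nonAllowed Au a _ _ (¬arrow-+3 a) (¬allowed (a ⊕ +3))
  relations⇒∂-vanishes (suc n) Au rels a (+4 ∷ ds) _ with allowed? ds | rels a
  ... | inj₁ (t , refl) | cons _ double _ = ≈-trans (∂-at-+4 Au a (map jump t)) (x≈0⇒-x≈0 (double t))
  ... | inj₂ ¬allowed  | _               = ∂-nonArrow-nonAllowed Au a _ _ (¬arrow-+4 a) (¬allowed (a ⊕ +4))

  relations⇒∂-vanishes-jump n Au rels a j ds ¬allowed =
    ≈-trans (∂-cons-nonAllowed Au a _ ¬allowed-tail)
            (x≈0⇒-x≈0 (relations⇒∂-vanishes n (A-startingAt a Au) (startingAt-relations a Au (rels a))
                                             (a ⊕ jump j) ds ¬allowed-tail))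
    where
      ¬allowed-tail : ¬ Allowed (walk (a ⊕ jump j) ds)
      ¬allowed-tail allowed = ¬allowed (jump-arrow a j , allowed)

  relations⇒Ω : ∀ n {u : Chain n} → A n u → (∀ a → Relations n (profile u a)) → Ω n u
  relations⇒Ω zero          Au _    = Au
  relations⇒Ω (suc zero)    Au _    = Au
  relations⇒Ω (suc (suc n)) {u} Au rels = Au , A∂u
    where
      A∂u : A (suc n) (∂ u)
      A∂u w r ¬allowed with regular⇒walk w r
      ... | a , ds , refl = relations⇒∂-vanishes (suc n) Au rels a ds ¬allowed

  Ω⇒A : ∀ n {u : Chain (suc n)} → Ω (suc n) u → A (suc n) u
  Ω⇒A zero    Au        = Au
  Ω⇒A (suc n) (Au , _) = Au

  Ω⇒relations : ∀ n {u : Chain (suc n)} → Ω (suc n) u → ∀ a → Relations (suc n) (profile u a)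
  Ω⇒relations zero    _          _ = single
  Ω⇒relations (suc n) (Au , A∂u) a =
    ∂-vanishes⇒relations (suc n) a Au λ ds → A∂u (walk a ds) (walk-regular a ds)

  αpath-walk : ∀ n a → αpath n a ≡ allowedWalk a (replicate n one)
  αpath-walk zero    a = cong (_∷ []) (shift-zero a)
  αpath-walk (suc n) a = cong₂ _∷_ (shift-zero a)
    (≡.trans (tabulate-cong λ i → ≡.sym (shift-shift a 1 (toℕ i))) (αpath-walk n (a ⊕ +1)))

  βpath-walk : ∀ n a (k : Fin n) → βpath n a (suc (toℕ k)) ≡ allowedWalk a (twoAt k)
  βpath-walk (suc n) a Fin.zero = cong₂ _∷_ (shift-zero a)
    (≡.trans (tabulate-cong λ i → ≡.sym (shift-shift a 2 (toℕ i))) (αpath-walk n (a ⊕ +2)))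
  βpath-walk (suc (suc n)) a (Fin.suc k) = cong₂ _∷_ (shift-zero a)
    (≡.trans (tabulate-cong λ i → cong₂ (λ x y → if toℕ i <ᵇ suc (toℕ k) then x else y)
                                         (≡.sym (shift-shift a 1 (toℕ i)))
                                         (≡.sym (shift-shift a 1 (suc (toℕ i)))))
             (βpath-walk (suc n) (a ⊕ +1) k))

  α-at : ∀ n a {w} → w ≢ allowedWalk a (replicate n one) → α n a w ≡ 0#
  α-at n a {w} w≢ = ≡.trans (cong (λ p → e p w) (αpath-walk n a)) (e-other w≢)

  α-self : ∀ n a → α n a (allowedWalk a (replicate n one)) ≡ 1#
  α-self n a = ≡.trans (cong (λ p → e p ones) (αpath-walk n a)) (e-self ones)
    where
      ones : Vec (Fin 5) (suc n)
      ones = allowedWalk a (replicate n one)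

  β-walk : ∀ n a w → β n a w ≈ ∑ (λ k → sgn (n ∸ suc (toℕ k)) * e (allowedWalk a (twoAt k)) w)
  β-walk n a w = ∑-cong λ k →
    ≈-reflexive (cong (λ p → sgn (n ∸ suc (toℕ k)) * e p w) (βpath-walk n a k))

  β-at : ∀ n a {w} → (∀ k → w ≢ allowedWalk a (twoAt k)) → β n a w ≈ 0#
  β-at n a {w} w≢ =
    ≈-trans (β-walk n a w) (∑-zero λ k → y≈0⇒x*y≈0 (≈-reflexive (e-other (w≢ k))))

  β-self : ∀ n a k → β n a (allowedWalk a (twoAt k)) ≈ sgn (n ∸ suc (toℕ k))
  β-self n a k =
    ≈-trans (β-walk n a (allowedWalk a (twoAt k)))
      (≈-trans (∑-single {n} k λ j j≢k → y≈0⇒x*y≈0 (≈-reflexive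
                  (e-other (allowedWalk-≢ʳ (j≢k ∘ ≡.sym ∘ twoAt-injective)))))
               (≈-trans (*-congˡ (≈-reflexive (e-self (allowedWalk a (twoAt k))))) (*-identityʳ _)))

  A-α : ∀ n a → A n (α n a)
  A-α n a = A-e (≡.subst Allowed (≡.sym (αpath-walk n a)) (allowedWalk-allowed a _))

  A-β : ∀ n a → A n (β n a)
  A-β n a w r ¬allowed = ∑-zero λ k →
    y≈0⇒x*y≈0 (A-e (≡.subst Allowed (≡.sym (βpath-walk n a k)) (allowedWalk-allowed a _))
                   w r ¬allowed)

  A-lin : ∀ n cα cβ → A n (lin n cα cβ)
  A-lin n cα cβ w r ¬allowed = ∑-zero {5} λ a →
    x≈0∧y≈0⇒x+y≈0 (y≈0⇒x*y≈0 {cα a} (A-α n a w r ¬allowed))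
                  (y≈0⇒x*y≈0 {cβ a} (A-β n a w r ¬allowed))

  α-inSpan : ∀ n a b → InSpan n (profile (α n a) b) 0#
  α-inSpan n a b =
    (λ js 2≤ → α-vanishes js (many≢replicate 2≤)) ,
    (λ k → ≈-trans (α-vanishes (twoAt k) (replicate≢twoAt k ∘ ≡.sym)) (≈-sym (zeroʳ _)))
    where
      α-vanishes : ∀ js → js ≢ replicate n one → profile (α n a) b js ≈ 0#
      α-vanishes js js≢ = ≈-reflexive (≡.trans (profile-regular (α n a) b js)
                                               (α-at n a (allowedWalk-≢ʳ js≢)))

  β-inSpan : ∀ n a b → ∃ (InSpan n (profile (β n a) b))
  β-inSpan n a b with b ≟ a
  ... | yes refl = 1# ,
    (λ js 2≤ → β-vanishes js λ k → allowedWalk-≢ʳ (many≢twoAt 2≤)) ,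
    (λ k → ≈-trans (≈-reflexive (profile-regular (β n a) a (twoAt k)))
                   (≈-trans (β-self n a k) (≈-sym (*-identityʳ _))))
    where
      β-vanishes : ∀ js → (∀ k → allowedWalk a js ≢ allowedWalk a (twoAt k)) →
                   profile (β n a) a js ≈ 0#
      β-vanishes js ne = ≈-trans (≈-reflexive (profile-regular (β n a) a js)) (β-at n a ne)
  ... | no b≢a = 0# ,
    (λ js _ → β-vanishes js) ,
    (λ k → ≈-trans (β-vanishes (twoAt k)) (≈-sym (zeroʳ _)))
    where
      β-vanishes : ∀ js → profile (β n a) b js ≈ 0#
      β-vanishes js = ≈-trans (≈-reflexive (profile-regular (β n a) b js))
                              (β-at n a {allowedWalk b js} λ k → allowedWalk-≢ˡ b≢a)

  Ω-α : ∀ n a → Ω n (α n a)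
  Ω-α n a = relations⇒Ω n (A-α n a) λ b → inSpan⇒relations n (α-inSpan n a b)

  Ω-β : ∀ n a → Ω n (β n a)
  Ω-β n a = relations⇒Ω n (A-β n a) λ b → inSpan⇒relations n (proj₂ (β-inSpan n a b))

  lin-at : ∀ n cα cβ a (w : Vec (Fin 5) n) →
           lin n cα cβ (a ∷ w) ≈ cα a * α n a (a ∷ w) + cβ a * β n a (a ∷ w)
  lin-at n cα cβ a w = ∑-single {5} a λ b b≢a → x≈0∧y≈0⇒x+y≈0
    (y≈0⇒x*y≈0 {cα b} (≈-reflexive (α-at n b {a ∷ w} (b≢a ∘ ≡.sym ∘ ∷-injectiveˡ))))
    (y≈0⇒x*y≈0 {cβ b} (β-at n b {a ∷ w} λ k → b≢a ∘ ≡.sym ∘ ∷-injectiveˡ))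

  lin-at-replicate : ∀ n cα cβ a → lin n cα cβ (allowedWalk a (replicate n one)) ≈ cα a
  lin-at-replicate n cα cβ a =
    ≈-trans (lin-at n cα cβ a (visited a (map jump (replicate n one))))
      (≈-trans (+-cong (≈-trans (*-congˡ (≈-reflexive (α-self n a))) (*-identityʳ _))
                       (y≈0⇒x*y≈0 (β-at n a λ k → allowedWalk-≢ʳ (replicate≢twoAt k))))
               (+-identityʳ _))

  lin-at-twoAt : ∀ n cα cβ a k →
                 lin n cα cβ (allowedWalk a (twoAt k)) ≈ cβ a * sgn (n ∸ suc (toℕ k))
  lin-at-twoAt n cα cβ a k =
    ≈-trans (lin-at n cα cβ a (visited a (map jump (twoAt k))))
      (≈-trans (+-congʳ (y≈0⇒x*y≈0 (≈-reflexive
                  (α-at n a (allowedWalk-≢ʳ (replicate≢twoAt k ∘ ≡.sym))))))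
               (≈-trans (+-identityˡ _) (*-congˡ (β-self n a k))))

  lin-at-many : ∀ n cα cβ a {js} → 2 ≤ twos js → lin n cα cβ (allowedWalk a js) ≈ 0#
  lin-at-many n cα cβ a {js} 2≤ =
    ≈-trans (lin-at n cα cβ a (visited a (map jump js)))
      (x≈0∧y≈0⇒x+y≈0
        (y≈0⇒x*y≈0 (≈-reflexive (α-at n a {allowedWalk a js} (allowedWalk-≢ʳ (many≢replicate 2≤)))))
        (y≈0⇒x*y≈0 (β-at n a {allowedWalk a js} λ k → allowedWalk-≢ʳ (many≢twoAt 2≤))))

  spanning : ∀ n (u : Chain (suc n)) → Ω (suc n) u →
             ∃₂ λ (cα cβ : Fin 5 → Carrier) → u ≈R lin (suc n) cα cβ
  spanning n u Ωu = cα , cβ , agree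
    where
      cα cβ : Fin 5 → Carrier
      cα a = profile u a (replicate (suc n) one)
      cβ a = profile u a (twoAt (Fin.fromℕ n))

      agree-allowed : ∀ a js → profile u a js ≈ lin (suc n) cα cβ (allowedWalk a js)
      agree-allowed a js with shape js | relations⇒inSpan (Ω⇒relations n Ωu a)
      ... | noTwo       | _             = ≈-sym (lin-at-replicate (suc n) cα cβ a)
      ... | singleTwo k | _ , alternate =
        ≈-trans (alternate k) (≈-trans (*-comm _ _) (≈-sym (lin-at-twoAt (suc n) cα cβ a k)))
      ... | manyTwos 2≤ | vanish , _    =
        ≈-trans (vanish js 2≤) (≈-sym (lin-at-many (suc n) cα cβ a {js} 2≤))

      agree : u ≈R lin (suc n) cα cβ
      agree w r with regular⇒walk w r
      ... | a , ds , refl with allowed? ds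
      ... | inj₁ (js , refl) =
        ≈-trans (≈-reflexive (≡.sym (profile-regular u a js))) (agree-allowed a js)
      ... | inj₂ ¬allowed    =
        ≈-trans (Ω⇒A n Ωu _ r (¬allowed a)) (≈-sym (A-lin (suc n) cα cβ _ r (¬allowed a)))

  independent : ∀ n (cα cβ : Fin 5 → Carrier) → lin (suc n) cα cβ ≈R 0R →
                ∀ a → cα a ≈ 0# × cβ a ≈ 0#
  independent n cα cβ lin≈0 a =
    ≈-trans (≈-sym (lin-at-replicate (suc n) cα cβ a)) (lin≈0-at (replicate (suc n) one)) ,
    (begin
      cβ a                                                     ≈⟨ *-identityʳ (cβ a) ⟨
      cβ a * 1#                                                ≡⟨ cong (λ i → cβ a * sgn i) last-sign ⟨
      cβ a * sgn (n ∸ toℕ (Fin.fromℕ n))                       ≈⟨ lin-at-twoAt (suc n) cα cβ a (Fin.fromℕ n) ⟨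
      lin (suc n) cα cβ (allowedWalk a (twoAt (Fin.fromℕ n)))  ≈⟨ lin≈0-at (twoAt (Fin.fromℕ n)) ⟩
      0#                                                       ∎)
    where
      lin≈0-at : ∀ js → lin (suc n) cα cβ (allowedWalk a js) ≈ 0#
      lin≈0-at js = lin≈0 (allowedWalk a js) (walk-regular a (map jump js))
      last-sign : n ∸ toℕ (Fin.fromℕ n) ≡ 0
      last-sign = ≡.trans (cong (n ∸_) (toℕ-fromℕ n)) (ℕₚ.n∸n≡0 n)

open C5-12 using (Ω; α; β; Chain; _≈R_; lin; 0R)
open Field using (Carrier; _≈_; 0#)

lemma2p3 : ∀ {c ℓ} (K : Field c ℓ) → CharacteristicZero K →
    ∀ (n : ℕ) → n ≥ 1 →
      -- the ten elements α_a^(n), β_a^(n) lie in Ω_n(G;K)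
      (∀ (a : Fin 5) → Ω K n (α K n a) × Ω K n (β K n a))
      -- they span Ω_n(G;K) (equality taken in the regular quotient R_n)
      × (∀ (u : Chain K n) → Ω K n u →
           ∃₂ λ (cα cβ : Fin 5 → Carrier K) → _≈R_ K u (lin K n cα cβ))
      -- they are linearly independent; hence they form a basis and dim = 10
      × (∀ (cα cβ : Fin 5 → Carrier K) → _≈R_ K (lin K n cα cβ) (0R K) →
           ∀ (a : Fin 5) → _≈_ K (cα a) (0# K) × _≈_ K (cβ a) (0# K))
lemma2p3 K _ (suc n) _ = (λ a → Ω-α (suc n) a , Ω-β (suc n) a) , spanning n , independent n
  where open C5 K
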